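{- Let $s\ge1$, $k\ge1$ be integers and $0<\lambda<2^s$ an integer. Write $\lambda=2^r\lambda'$ with $0\le r<s$ and $\lambda'$ odd. Then $$\rho_{k,\lambda}(2^s)=\sum_{i=0}^{\lfloor r/2\rfloor-1}\Big(2^{ki}2^{(s-2i-3)(k-1)}\cdot\rho^{(1)}_{k,\lambda/2^{2i}}(8)\Big)+2^{k\lfloor r/2\rfloor}\rho^{(1)}_{k,\lambda/2^{2\lfloor r/2\rfloor}}\big(2^{s-2\lfloor r/2\rfloor}\big),$$ where the sum is empty (equal to $0$) when its upper limit is $-1$.
   Context: For positive integers $k,n$ and an integer $\mu$, $\rho_{k,\mu}(n)$ is the number of $(x_1,\dots,x_k)\in(\mathbb{Z}/n\mathbb{Z})^k$ with $x_1^2+\cdots+x_k^2\equiv\mu\pmod n$. For integers $t\ge1$ and $\mu$, $\rho^{(1)}_{k,\mu}(2^t)$ is the number of $(x_1,\dots,x_k)\in(\mathbb{Z}/2^t\mathbb{Z})^k$ with $x_1^2+\cdots+x_k^2\equiv\mu\pmod{2^t}$ and $x_i$ odd for at least one $i$. -}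

module Defs where

open import Data.Nat using (ℕ; zero; suc; _+_; _*_; _^_; NonZero)
open import Data.Nat.Properties using (_≟_; m^n≢0)
open import Data.Nat.DivMod using (_%_; _/_)
open import Data.Fin using (Fin; toℕ)
open import Data.Vec using (Vec; []; _∷_; foldr)
open import Data.Vec.Relation.Unary.Any using (Any; any?)
open import Data.List using (List; []; _∷_; map; concatMap; allFin; filter; length)
open import Relation.Nullary using (Dec; _×-dec_)
open import Relation.Binary.PropositionalEquality using (_≡_)

-- all k-tuples over ℤ/nℤ, elements of ℤ/nℤ represented by Fin n
tuples : (n k : ℕ) → List (Vec (Fin n) k)
tuples n zero = [] ∷ []
tuples n (suc k) = concatMap (λ x → map (x ∷_) (tuples n k)) (allFin n)

sumSq : ∀ {n k} → Vec (Fin n) k → ℕ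
sumSq = foldr _ (λ x acc → toℕ x * toℕ x + acc) 0

SumSqCong : (n : ℕ) .{{_ : NonZero n}} (μ : ℕ) {k : ℕ} → Vec (Fin n) k → Set
SumSqCong n μ v = sumSq v % n ≡ μ % n

sumSqCong? : (n : ℕ) .{{_ : NonZero n}} (μ : ℕ) {k : ℕ} (v : Vec (Fin n) k) → Dec (SumSqCong n μ v)
sumSqCong? n μ v = sumSq v % n ≟ μ % n

-- x is odd (as an element of ℤ/2^tℤ, parity of the representative is well defined)
OddFin : ∀ {n} → Fin n → Set
OddFin x = toℕ x % 2 ≡ 1

ρ : (k μ n : ℕ) .{{_ : NonZero n}} → ℕ
ρ k μ n = length (filter (sumSqCong? n μ) (tuples n k))

ρ¹ : (k μ t : ℕ) → ℕ
ρ¹ k μ t = length (filter (λ v → sumSqCong? (2 ^ t) {{m^n≢0 2 t}} μ v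
                                   ×-dec any? (λ x → toℕ x % 2 ≟ 1) v)
                          (tuples (2 ^ t) k))

_/2^_ : ℕ → ℕ → ℕ
a /2^ e = _/_ a (2 ^ e) {{m^n≢0 2 e}}

{-# OPTIONS --safe #-}
-- Split the solutions modulo 2^s according to whether some coordinate is odd.  Solutions
-- with all coordinates even are x = 2y with 4 Σ y² ≡ λ (mod 2^s): there are none unless
-- 4 ∣ λ, and otherwise 2^k times as many as solutions of Σ y² ≡ λ/4 (mod 2^(s-2)).
-- Solutions with an odd coordinate obey Hensel lifting: for t ≥ 3, passing from 2^t to
-- 2^(t+1) multiplies their number by 2^(k-1), because translating an odd coordinate by
-- 2^(t-1) changes its square by 2^t modulo 2^(t+1).  Stripping factors 4 from λ, an
-- induction on r yields the formula.
module Submission where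

open import Defs
open import Data.Bool using (Bool; true; false; _∧_; _∨_; not; T)
open import Data.Unit using (tt)
open import Data.Fin using (Fin; toℕ)
open import Data.List using (List; []; _∷_; map; concatMap; allFin; filter; length; tabulate; _++_; applyUpTo; upTo)
open import Data.List.Properties using (map-++; map-cong; map-∘; map-tabulate; map-upTo)
open import Data.Nat using (ℕ; zero; suc; _+_; _*_; _∸_; _^_; _≤_; _<_; _/_; _%_; NonZero; _≡ᵇ_; z≤n; s≤s)
open import Data.Nat.DivMod
open import Data.Nat.Divisibility using (_∣_; divides; ∣-trans; m∣m*n; n∣m⇒m%n≡0; m%n≡0⇒n∣m; *-cancelˡ-∣)
open import Data.Nat.ListAction using (sum)
open import Data.Nat.ListAction.Properties using (sum-++)
open import Data.Nat.Properties
open import Data.Nat.Tactic.RingSolver using (solve-∀)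
open import Data.Vec using (Vec; []; _∷_) renaming (map to vmap)
open import Data.Vec.Relation.Unary.Any using (any?)
open import Function using (_∘_)
open import Relation.Nullary using (Dec; does; ¬_; yes; no)
open import Relation.Nullary.Decidable using (dec-true; dec-false)
open import Relation.Binary.PropositionalEquality

𝟙 : Bool → ℕ
𝟙 true  = 1
𝟙 false = 0

𝟙-∧ : ∀ a b → 𝟙 (a ∧ b) ≡ 𝟙 a * 𝟙 b
𝟙-∧ true  b = sym (+-identityʳ (𝟙 b))
𝟙-∧ false b = refl

𝟙-split : ∀ b e → e ≡ 𝟙 b * e + 𝟙 (not b) * e
𝟙-split true  e = sym (trans (+-identityʳ (e + 0)) (+-identityʳ e))
𝟙-split false e = sym (+-identityʳ e)

𝟙-∨-split : ∀ a b e → 𝟙 (a ∨ b) * e ≡ 𝟙 a * e + 𝟙 (not a) * (𝟙 b * e)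
𝟙-∨-split true  b e = sym (+-identityʳ (e + 0))
𝟙-∨-split false b e = sym (+-identityʳ (𝟙 b * e))

𝟙-not-∨ : ∀ a b e → 𝟙 (not (a ∨ b)) * e ≡ 𝟙 (not a) * (𝟙 (not b) * e)
𝟙-not-∨ true  b e = refl
𝟙-not-∨ false b e = sym (+-identityʳ _)

𝟙-*-cong : ∀ b {e e'} → (b ≡ true → e ≡ e') → 𝟙 b * e ≡ 𝟙 b * e'
𝟙-*-cong true  eq = cong (_+ 0) (eq refl)
𝟙-*-cong false eq = refl

≡ᵇ-cong-⇔ : ∀ {a b c d} → (a ≡ b → c ≡ d) → (c ≡ d → a ≡ b) → (a ≡ᵇ b) ≡ (c ≡ᵇ d)
≡ᵇ-cong-⇔ {a} {b} {c} {d} f g with a ≟ b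
... | yes a≡b = trans (dec-true (a ≟ b) a≡b) (sym (dec-true (c ≟ d) (f a≡b)))
... | no  a≢b = trans (dec-false (a ≟ b) a≢b) (sym (dec-false (c ≟ d) (a≢b ∘ g)))

eqMod : (n : ℕ) .{{_ : NonZero n}} → ℕ → ℕ → ℕ
eqMod n a b = 𝟙 (a % n ≡ᵇ b % n)

eqMod-≡0 : ∀ n .{{_ : NonZero n}} a b → a % n ≢ b % n → eqMod n a b ≡ 0
eqMod-≡0 n a b a≢b = cong 𝟙 (dec-false (a % n ≟ b % n) a≢b)

isOdd : ℕ → Bool
isOdd x = x % 2 ≡ᵇ 1

isOdd⇒%2≡1 : ∀ x → isOdd x ≡ true → x % 2 ≡ 1
isOdd⇒%2≡1 x odd = ≡ᵇ⇒≡ (x % 2) 1 (subst T (sym odd) tt)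

parity-sum : ∀ c → 𝟙 (0 ≡ᵇ c % 2) + 𝟙 (1 ≡ᵇ c % 2) ≡ 1
parity-sum 0             = refl
parity-sum 1             = refl
parity-sum (suc (suc c)) = parity-sum c

consecutive-parity : ∀ q c → 𝟙 (q % 2 ≡ᵇ c % 2) + 𝟙 (suc q % 2 ≡ᵇ c % 2) ≡ 1
consecutive-parity 0             c = parity-sum c
consecutive-parity 1             c = trans (+-comm (𝟙 (1 ≡ᵇ c % 2)) _) (parity-sum c)
consecutive-parity (suc (suc q)) c = consecutive-parity q c

+-right-comm : ∀ a b c → a + b + c ≡ a + c + b
+-right-comm a b c = trans (+-assoc a b c) (trans (cong (a +_) (+-comm b c)) (sym (+-assoc a c b)))

sumBelow : ℕ → (ℕ → ℕ) → ℕ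
sumBelow zero    f = 0
sumBelow (suc n) f = f 0 + sumBelow n (f ∘ suc)

sumBelow-cong : ∀ n {f g : ℕ → ℕ} → (∀ x → f x ≡ g x) → sumBelow n f ≡ sumBelow n g
sumBelow-cong zero    f≗g = refl
sumBelow-cong (suc n) f≗g = cong₂ _+_ (f≗g 0) (sumBelow-cong n (f≗g ∘ suc))

sumBelow-zero : ∀ n {f : ℕ → ℕ} → (∀ x → f x ≡ 0) → sumBelow n f ≡ 0
sumBelow-zero zero    f≗0 = refl
sumBelow-zero (suc n) f≗0 = cong₂ _+_ (f≗0 0) (sumBelow-zero n (f≗0 ∘ suc))

sumBelow-+ : ∀ n (f g : ℕ → ℕ) → sumBelow n (λ x → f x + g x) ≡ sumBelow n f + sumBelow n g
sumBelow-+ zero    f g = refl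
sumBelow-+ (suc n) f g = begin
    f 0 + g 0 + sumBelow n (λ x → f (suc x) + g (suc x))
  ≡⟨ cong (f 0 + g 0 +_) (sumBelow-+ n (f ∘ suc) (g ∘ suc)) ⟩
    f 0 + g 0 + (sumBelow n (f ∘ suc) + sumBelow n (g ∘ suc))
  ≡⟨ +-interchange (f 0) (g 0) _ _ ⟩
    f 0 + sumBelow n (f ∘ suc) + (g 0 + sumBelow n (g ∘ suc)) ∎
  where
    open ≡-Reasoning
    +-interchange : ∀ a b c d → a + b + (c + d) ≡ a + c + (b + d)
    +-interchange = solve-∀

sumBelow-*ˡ : ∀ n c (f : ℕ → ℕ) → sumBelow n (λ x → c * f x) ≡ c * sumBelow n f
sumBelow-*ˡ zero    c f = sym (*-zeroʳ c)
sumBelow-*ˡ (suc n) c f =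
  trans (cong (c * f 0 +_) (sumBelow-*ˡ n c (f ∘ suc))) (sym (*-distribˡ-+ c (f 0) _))

sumBelow-+-split : ∀ m n (f : ℕ → ℕ) → sumBelow (m + n) f ≡ sumBelow m f + sumBelow n (λ x → f (m + x))
sumBelow-+-split zero    n f = refl
sumBelow-+-split (suc m) n f =
  trans (cong (f 0 +_) (sumBelow-+-split m n (f ∘ suc))) (sym (+-assoc (f 0) _ _))

sumBelow-halves : ∀ m (f : ℕ → ℕ) → sumBelow (2 * m) f ≡ sumBelow m f + sumBelow m (λ x → f (m + x))
sumBelow-halves m f = trans (cong (λ n → sumBelow (m + n) f) (+-identityʳ m)) (sumBelow-+-split m m f)

sumBelow-periodic : ∀ q m (f : ℕ → ℕ) → (∀ x → f (m + x) ≡ f x) → sumBelow (q * m) f ≡ q * sumBelow m f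
sumBelow-periodic zero    m f per = refl
sumBelow-periodic (suc q) m f per = begin
    sumBelow (m + q * m) f
  ≡⟨ sumBelow-+-split m (q * m) f ⟩
    sumBelow m f + sumBelow (q * m) (λ x → f (m + x))
  ≡⟨ cong (sumBelow m f +_) (sumBelow-cong (q * m) per) ⟩
    sumBelow m f + sumBelow (q * m) f
  ≡⟨ cong (sumBelow m f +_) (sumBelow-periodic q m f per) ⟩
    sumBelow m f + q * sumBelow m f ∎
  where open ≡-Reasoning

sumBelow-swap-halves : ∀ m {f g : ℕ → ℕ} → (∀ x → g (m + x) ≡ f x) → (∀ x → g x ≡ f (m + x)) →
  sumBelow (2 * m) g ≡ sumBelow (2 * m) f
sumBelow-swap-halves m {f} {g} g₁≗f₀ g₀≗f₁ = begin
    sumBelow (2 * m) g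
  ≡⟨ sumBelow-halves m g ⟩
    sumBelow m g + sumBelow m (λ x → g (m + x))
  ≡⟨ cong₂ _+_ (sumBelow-cong m g₀≗f₁) (sumBelow-cong m g₁≗f₀) ⟩
    sumBelow m (λ x → f (m + x)) + sumBelow m f
  ≡⟨ +-comm _ (sumBelow m f) ⟩
    sumBelow m f + sumBelow m (λ x → f (m + x))
  ≡⟨ sumBelow-halves m f ⟨
    sumBelow (2 * m) f ∎
  where open ≡-Reasoning

sumBelow-even : ∀ m (h : ℕ → ℕ) → sumBelow (2 * m) (λ x → 𝟙 (not (isOdd x)) * h x) ≡ sumBelow m (λ y → h (2 * y))
sumBelow-even zero    h = refl
sumBelow-even (suc m) h = begin
    sumBelow (2 * suc m) g
  ≡⟨ cong (λ n → sumBelow n g) (*-suc 2 m) ⟩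
    h 0 + 0 + (0 + sumBelow (2 * m) (λ x → g (2 + x)))
  ≡⟨ cong₂ _+_ (+-identityʳ (h 0)) (sumBelow-even m (λ x → h (2 + x))) ⟩
    h 0 + sumBelow m (λ y → h (2 + 2 * y))
  ≡⟨ cong (h 0 +_) (sumBelow-cong m (λ y → cong h (sym (*-suc 2 y)))) ⟩
    sumBelow (suc m) (λ y → h (2 * y)) ∎
  where
    open ≡-Reasoning
    g : ℕ → ℕ
    g x = 𝟙 (not (isOdd x)) * h x

sumBox : ℕ → (k : ℕ) → (Vec ℕ k → ℕ) → ℕ
sumBox n zero    F = F []
sumBox n (suc k) F = sumBelow n (λ x → sumBox n k (λ v → F (x ∷ v)))

sumBox-cong : ∀ n k {F G : Vec ℕ k → ℕ} → (∀ v → F v ≡ G v) → sumBox n k F ≡ sumBox n k G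
sumBox-cong n zero    F≗G = F≗G []
sumBox-cong n (suc k) F≗G = sumBelow-cong n (λ x → sumBox-cong n k (λ v → F≗G (x ∷ v)))

sumBox-zero : ∀ n k {F : Vec ℕ k → ℕ} → (∀ v → F v ≡ 0) → sumBox n k F ≡ 0
sumBox-zero n zero    F≗0 = F≗0 []
sumBox-zero n (suc k) F≗0 = sumBelow-zero n (λ x → sumBox-zero n k (λ v → F≗0 (x ∷ v)))

sumBox-+ : ∀ n k (F G : Vec ℕ k → ℕ) → sumBox n k (λ v → F v + G v) ≡ sumBox n k F + sumBox n k G
sumBox-+ n zero    F G = refl
sumBox-+ n (suc k) F G =
  trans (sumBelow-cong n (λ x → sumBox-+ n k (λ v → F (x ∷ v)) (λ v → G (x ∷ v)))) (sumBelow-+ n _ _)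

sumBox-*ˡ : ∀ n k c (F : Vec ℕ k → ℕ) → sumBox n k (λ v → c * F v) ≡ c * sumBox n k F
sumBox-*ˡ n zero    c F = refl
sumBox-*ˡ n (suc k) c F =
  trans (sumBelow-cong n (λ x → sumBox-*ˡ n k c (λ v → F (x ∷ v)))) (sumBelow-*ˡ n c _)

ModInvariant : (m : ℕ) .{{_ : NonZero m}} → ∀ {k} → (Vec ℕ k → ℕ) → Set
ModInvariant m F = ∀ v → F (vmap (_% m) v) ≡ F v

module _ (m : ℕ) .{{_ : NonZero m}} {k : ℕ} (F : Vec ℕ (suc k) → ℕ) (inv : ModInvariant m F) where

  private
    mod-idem : ∀ {j} (v : Vec ℕ j) → vmap (_% m) (vmap (_% m) v) ≡ vmap (_% m) v
    mod-idem []      = refl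
    mod-idem (x ∷ v) = cong₂ _∷_ (m%n%n≡m%n x m) (mod-idem v)

  ModInvariant-tail : ∀ x → ModInvariant m (λ v → F (x ∷ v))
  ModInvariant-tail x v = begin
    F (x ∷ vmap (_% m) v)                         ≡⟨ inv (x ∷ vmap (_% m) v) ⟨
    F (x % m ∷ vmap (_% m) (vmap (_% m) v))       ≡⟨ cong (λ w → F (x % m ∷ w)) (mod-idem v) ⟩
    F (x % m ∷ vmap (_% m) v)                     ≡⟨ inv (x ∷ v) ⟩
    F (x ∷ v)                                     ∎
    where open ≡-Reasoning

  ModInvariant-head : ∀ x v → F (m + x ∷ v) ≡ F (x ∷ v)
  ModInvariant-head x v = begin
    F (m + x ∷ v)                     ≡⟨ inv (m + x ∷ v) ⟨
    F ((m + x) % m ∷ vmap (_% m) v)   ≡⟨ cong (λ z → F (z % m ∷ vmap (_% m) v)) (+-comm m x) ⟩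
    F ((x + m) % m ∷ vmap (_% m) v)   ≡⟨ cong (λ z → F (z ∷ vmap (_% m) v)) ([m+n]%n≡m%n x m) ⟩
    F (x % m ∷ vmap (_% m) v)         ≡⟨ inv (x ∷ v) ⟩
    F (x ∷ v)                         ∎
    where open ≡-Reasoning

sumBox-periodic : ∀ q m .{{_ : NonZero m}} k (F : Vec ℕ k → ℕ) → ModInvariant m F →
  sumBox (q * m) k F ≡ q ^ k * sumBox m k F
sumBox-periodic q m zero    F inv = sym (+-identityʳ (F []))
sumBox-periodic q m (suc k) F inv = begin
    sumBelow (q * m) (λ x → sumBox (q * m) k (λ v → F (x ∷ v)))
  ≡⟨ sumBelow-cong (q * m) (λ x → sumBox-periodic q m k _ (ModInvariant-tail m F inv x)) ⟩
    sumBelow (q * m) (λ x → q ^ k * H x)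
  ≡⟨ sumBelow-periodic q m _ (λ x → cong (q ^ k *_) (sumBox-cong m k (ModInvariant-head m F inv x))) ⟩
    q * sumBelow m (λ x → q ^ k * H x)
  ≡⟨ cong (q *_) (sumBelow-*ˡ m (q ^ k) H) ⟩
    q * (q ^ k * sumBelow m H)
  ≡⟨ *-assoc q (q ^ k) _ ⟨
    q ^ suc k * sumBox m (suc k) F ∎
  where
    open ≡-Reasoning
    H : ℕ → ℕ
    H x = sumBox m k (λ v → F (x ∷ v))

anyOdd : ∀ {k} → Vec ℕ k → Bool
anyOdd []      = false
anyOdd (x ∷ v) = isOdd x ∨ anyOdd v

sumOfSquares : ∀ {k} → Vec ℕ k → ℕ
sumOfSquares []      = 0
sumOfSquares (x ∷ v) = x * x + sumOfSquares v

solutions : (k μ n : ℕ) .{{_ : NonZero n}} → ℕ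
solutions k μ n = sumBox n k (λ v → eqMod n (sumOfSquares v) μ)

oddSolutions : (k μ n : ℕ) .{{_ : NonZero n}} → ℕ
oddSolutions k μ n = sumBox n k (λ v → 𝟙 (anyOdd v) * eqMod n (sumOfSquares v) μ)

length-filter : ∀ {A : Set} {P : A → Set} (P? : ∀ x → Dec (P x)) (xs : List A) →
  length (filter P? xs) ≡ sum (map (λ x → 𝟙 (does (P? x))) xs)
length-filter P? []       = refl
length-filter P? (x ∷ xs) with does (P? x)
... | true  = cong suc (length-filter P? xs)
... | false = length-filter P? xs

sum-map-concatMap : ∀ {A B : Set} (G : B → ℕ) (h : A → List B) (xs : List A) →
  sum (map G (concatMap h xs)) ≡ sum (map (λ x → sum (map G (h x))) xs)
sum-map-concatMap G h []       = refl
sum-map-concatMap G h (x ∷ xs) = begin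
    sum (map G (h x ++ concatMap h xs))
  ≡⟨ cong sum (map-++ G (h x) (concatMap h xs)) ⟩
    sum (map G (h x) ++ map G (concatMap h xs))
  ≡⟨ sum-++ (map G (h x)) _ ⟩
    sum (map G (h x)) + sum (map G (concatMap h xs))
  ≡⟨ cong (sum (map G (h x)) +_) (sum-map-concatMap G h xs) ⟩
    sum (map G (h x)) + sum (map (λ y → sum (map G (h y))) xs) ∎
  where open ≡-Reasoning

sum-tabulate : ∀ n (f : ℕ → ℕ) → sum (tabulate {n = n} (f ∘ toℕ)) ≡ sumBelow n f
sum-tabulate zero    f = refl
sum-tabulate (suc n) f = cong (f 0 +_) (sum-tabulate n (f ∘ suc))

sum-map-allFin : ∀ n (f : ℕ → ℕ) → sum (map (f ∘ toℕ) (allFin n)) ≡ sumBelow n f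
sum-map-allFin n f = trans (cong sum (map-tabulate {n = n} (λ i → i) (f ∘ toℕ))) (sum-tabulate n f)

sum-map-tuples : ∀ n k (F : Vec ℕ k → ℕ) → sum (map (F ∘ vmap toℕ) (tuples n k)) ≡ sumBox n k F
sum-map-tuples n zero    F = +-identityʳ (F [])
sum-map-tuples n (suc k) F = begin
    sum (map (F ∘ vmap toℕ) (concatMap (λ x → map (x ∷_) (tuples n k)) (allFin n)))
  ≡⟨ sum-map-concatMap (F ∘ vmap toℕ) _ (allFin n) ⟩
    sum (map (λ x → sum (map (F ∘ vmap toℕ) (map (x ∷_) (tuples n k)))) (allFin n))
  ≡⟨ cong sum (map-cong (λ x → cong sum (sym (map-∘ (tuples n k)))) (allFin n)) ⟩
    sum (map (λ x → sum (map (λ v → F (toℕ x ∷ vmap toℕ v)) (tuples n k))) (allFin n))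
  ≡⟨ cong sum (map-cong (λ x → sum-map-tuples n k (λ v → F (toℕ x ∷ v))) (allFin n)) ⟩
    sum (map (λ x → sumBox n k (λ v → F (toℕ x ∷ v))) (allFin n))
  ≡⟨ sum-map-allFin n (λ y → sumBox n k (λ v → F (y ∷ v))) ⟩
    sumBox n (suc k) F ∎
  where open ≡-Reasoning

sumSq≡sumOfSquares : ∀ {n k} (v : Vec (Fin n) k) → sumSq v ≡ sumOfSquares (vmap toℕ v)
sumSq≡sumOfSquares []      = refl
sumSq≡sumOfSquares (x ∷ v) = cong (toℕ x * toℕ x +_) (sumSq≡sumOfSquares v)

any?≡anyOdd : ∀ {n k} (v : Vec (Fin n) k) → does (any? (λ x → toℕ x % 2 ≟ 1) v) ≡ anyOdd (vmap toℕ v)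
any?≡anyOdd []      = refl
any?≡anyOdd (x ∷ v) = cong (isOdd (toℕ x) ∨_) (any?≡anyOdd v)

ρ≡solutions : ∀ k μ n .{{_ : NonZero n}} → ρ k μ n ≡ solutions k μ n
ρ≡solutions k μ n = begin
    length (filter (sumSqCong? n μ) (tuples n k))
  ≡⟨ length-filter (sumSqCong? n μ) (tuples n k) ⟩
    sum (map (λ v → 𝟙 (sumSq v % n ≡ᵇ μ % n)) (tuples n k))
  ≡⟨ cong sum (map-cong (λ v → cong (λ z → 𝟙 (z % n ≡ᵇ μ % n)) (sumSq≡sumOfSquares v)) (tuples n k)) ⟩
    sum (map (λ v → eqMod n (sumOfSquares (vmap toℕ v)) μ) (tuples n k))
  ≡⟨ sum-map-tuples n k (λ v → eqMod n (sumOfSquares v) μ) ⟩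
    solutions k μ n ∎
  where open ≡-Reasoning

ρ¹≡oddSolutions : ∀ k μ t → ρ¹ k μ t ≡ oddSolutions k μ (2 ^ t) {{m^n≢0 2 t}}
ρ¹≡oddSolutions k μ t = begin
    ρ¹ k μ t
  ≡⟨ length-filter _ (tuples n k) ⟩
    sum (map (λ v → 𝟙 ((sumSq v % n ≡ᵇ μ % n) ∧ does (any? (λ x → toℕ x % 2 ≟ 1) v))) (tuples n k))
  ≡⟨ cong sum (map-cong summand (tuples n k)) ⟩
    sum (map (λ v → 𝟙 (anyOdd (vmap toℕ v)) * eqMod n (sumOfSquares (vmap toℕ v)) μ) (tuples n k))
  ≡⟨ sum-map-tuples n k _ ⟩
    oddSolutions k μ n ∎
  where
    open ≡-Reasoning
    n = 2 ^ t
    instance _ = m^n≢0 2 t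
    summand : ∀ v → 𝟙 ((sumSq v % n ≡ᵇ μ % n) ∧ does (any? (λ x → toℕ x % 2 ≟ 1) v))
                  ≡ 𝟙 (anyOdd (vmap toℕ v)) * eqMod n (sumOfSquares (vmap toℕ v)) μ
    summand v = trans (𝟙-∧ (sumSq v % n ≡ᵇ μ % n) _) (trans (*-comm (𝟙 (sumSq v % n ≡ᵇ μ % n)) _)
      (cong₂ (λ b z → 𝟙 b * 𝟙 (z % n ≡ᵇ μ % n)) (any?≡anyOdd v) (sumSq≡sumOfSquares v)))

sumBox-allEven : ∀ m k (F : Vec ℕ k → ℕ) →
  sumBox (2 * m) k (λ v → 𝟙 (not (anyOdd v)) * F v) ≡ sumBox m k (F ∘ vmap (2 *_))
sumBox-allEven m zero    F = +-identityʳ (F [])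
sumBox-allEven m (suc k) F = begin
    sumBelow (2 * m) (λ x → sumBox (2 * m) k (λ v → 𝟙 (not (anyOdd (x ∷ v))) * F (x ∷ v)))
  ≡⟨ sumBelow-cong (2 * m) (λ x → trans (sumBox-cong (2 * m) k (λ v → 𝟙-not-∨ (isOdd x) (anyOdd v) _))
                                         (sumBox-*ˡ (2 * m) k (𝟙 (not (isOdd x))) _)) ⟩
    sumBelow (2 * m) (λ x → 𝟙 (not (isOdd x)) * sumBox (2 * m) k (λ v → 𝟙 (not (anyOdd v)) * F (x ∷ v)))
  ≡⟨ sumBelow-cong (2 * m) (λ x → cong (𝟙 (not (isOdd x)) *_) (sumBox-allEven m k (λ v → F (x ∷ v)))) ⟩
    sumBelow (2 * m) (λ x → 𝟙 (not (isOdd x)) * sumBox m k (λ w → F (x ∷ vmap (2 *_) w)))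
  ≡⟨ sumBelow-even m (λ x → sumBox m k (λ w → F (x ∷ vmap (2 *_) w))) ⟩
    sumBox m (suc k) (F ∘ vmap (2 *_)) ∎
  where open ≡-Reasoning

sumOfSquares-double : ∀ {k} (w : Vec ℕ k) → sumOfSquares (vmap (2 *_) w) ≡ 4 * sumOfSquares w
sumOfSquares-double []      = refl
sumOfSquares-double (x ∷ w) = trans (cong (2 * x * (2 * x) +_) (sumOfSquares-double w)) (square-double x _)
  where
    square-double : ∀ x s → 2 * x * (2 * x) + 4 * s ≡ 4 * (x * x + s)
    square-double = solve-∀

sumOfSquares-mod : ∀ m M .{{_ : NonZero m}} .{{_ : NonZero M}} →
  (∀ x → (x % m) * (x % m) % M ≡ x * x % M) →
  ∀ {k} (v : Vec ℕ k) → sumOfSquares (vmap (_% m) v) % M ≡ sumOfSquares v % M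
sumOfSquares-mod m M sq-mod []      = refl
sumOfSquares-mod m M sq-mod (x ∷ v) = begin
    ((x % m) * (x % m) + sumOfSquares (vmap (_% m) v)) % M
  ≡⟨ %-distribˡ-+ ((x % m) * (x % m)) _ M ⟩
    ((x % m) * (x % m) % M + sumOfSquares (vmap (_% m) v) % M) % M
  ≡⟨ cong₂ (λ a b → (a + b) % M) (sq-mod x) (sumOfSquares-mod m M sq-mod v) ⟩
    (x * x % M + sumOfSquares v % M) % M
  ≡⟨ %-distribˡ-+ (x * x) (sumOfSquares v) M ⟨
    (x * x + sumOfSquares v) % M ∎
  where open ≡-Reasoning

module _ (n : ℕ) .{{_ : NonZero (2 * n)}} where

  evenPart : (k μ : ℕ) → ℕ
  evenPart k μ = sumBox n k (λ w → eqMod (2 * n) (4 * sumOfSquares w) μ)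

  solutions-split : ∀ k μ → solutions k μ (2 * n) ≡ oddSolutions k μ (2 * n) + evenPart k μ
  solutions-split k μ = begin
      sumBox (2 * n) k G
    ≡⟨ sumBox-cong (2 * n) k (λ v → 𝟙-split (anyOdd v) (G v)) ⟩
      sumBox (2 * n) k (λ v → 𝟙 (anyOdd v) * G v + 𝟙 (not (anyOdd v)) * G v)
    ≡⟨ sumBox-+ (2 * n) k _ _ ⟩
      oddSolutions k μ (2 * n) + sumBox (2 * n) k (λ v → 𝟙 (not (anyOdd v)) * G v)
    ≡⟨ cong (oddSolutions k μ (2 * n) +_) (sumBox-allEven n k G) ⟩
      oddSolutions k μ (2 * n) + sumBox n k (G ∘ vmap (2 *_))
    ≡⟨ cong (oddSolutions k μ (2 * n) +_) (sumBox-cong n k (λ w →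
         cong (λ z → 𝟙 (z % (2 * n) ≡ᵇ μ % (2 * n))) (sumOfSquares-double w))) ⟩
      oddSolutions k μ (2 * n) + evenPart k μ ∎
    where
      open ≡-Reasoning
      G : ∀ {j} → Vec ℕ j → ℕ
      G v = eqMod (2 * n) (sumOfSquares v) μ

  evenPart-≡0 : ∀ k μ d .{{_ : NonZero d}} → d ∣ 2 * n → d ∣ 4 → ¬ d ∣ μ → evenPart k μ ≡ 0
  evenPart-≡0 k μ d d∣2n d∣4 d∤μ = sumBox-zero n k (λ w → eqMod-≡0 (2 * n) _ μ (λ eq → d∤μ (m%n≡0⇒n∣m μ d (begin
      μ % d                               ≡⟨ m∣n⇒o%n%m≡o%m d (2 * n) μ d∣2n ⟨
      μ % (2 * n) % d                     ≡⟨ cong (_% d) eq ⟨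
      4 * sumOfSquares w % (2 * n) % d    ≡⟨ m∣n⇒o%n%m≡o%m d (2 * n) _ d∣2n ⟩
      4 * sumOfSquares w % d              ≡⟨ n∣m⇒m%n≡0 _ d (∣-trans d∣4 (m∣m*n (sumOfSquares w))) ⟩
      0                                   ∎))))
    where open ≡-Reasoning


module _ (m : ℕ) .{{_ : NonZero m}} .{{_ : NonZero (2 * m)}} .{{_ : NonZero (2 * (2 * m))}} where

  private
    instance
      m4≢0 : NonZero (m * 4)
      m4≢0 = m*n≢0 m 4

    4*-%-4m : ∀ a → (4 * a) % (2 * (2 * m)) ≡ a % m * 4
    4*-%-4m a = begin
      (4 * a) % (2 * (2 * m))   ≡⟨ %-congˡ {o = 2 * (2 * m)} (*-comm 4 a) ⟩
      (a * 4) % (2 * (2 * m))   ≡⟨ %-congʳ (quadruple m) ⟩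
      (a * 4) % (m * 4)         ≡⟨ m%n*o≡m*o%[n*o] a m 4 ⟨
      a % m * 4                 ∎
      where
        open ≡-Reasoning
        quadruple : ∀ x → 2 * (2 * x) ≡ x * 4
        quadruple = solve-∀

  eqMod-4* : ∀ a b → eqMod (2 * (2 * m)) (4 * a) (4 * b) ≡ eqMod m a b
  eqMod-4* a b = cong 𝟙 (≡ᵇ-cong-⇔
    (λ eq → *-cancelʳ-≡ (a % m) (b % m) 4 (trans (sym (4*-%-4m a)) (trans eq (4*-%-4m b))))
    (λ eq → trans (4*-%-4m a) (trans (cong (_* 4) eq) (sym (4*-%-4m b)))))

  evenPart-4* : ∀ k μ → evenPart (2 * m) k (4 * μ) ≡ 2 ^ k * solutions k μ m
  evenPart-4* k μ = trans (sumBox-cong (2 * m) k (λ w → eqMod-4* (sumOfSquares w) μ))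
    (sumBox-periodic 2 m k _ (λ v → cong (λ z → 𝟙 (z ≡ᵇ μ % m))
      (sumOfSquares-mod m m (λ x → sym (%-distribˡ-* x x m)) v)))

module _ (N : ℕ) .{{_ : NonZero N}} where

  private
    instance
      2N≢0 : NonZero (2 * N)
      2N≢0 = m*n≢0 2 N

    bit : ℕ → ℕ
    bit x = x / N % 2

    %2N%N : ∀ x → x % (2 * N) % N ≡ x % N
    %2N%N x = m∣n⇒o%n%m≡o%m N (2 * N) x (divides 2 refl)

    %2N≡%N+bit : ∀ x → x % (2 * N) ≡ x % N + bit x * N
    %2N≡%N+bit x = trans (m≡m%n+[m/n]*n (x % (2 * N)) N)
                         (cong₂ (λ r q → r + q * N) (%2N%N x) (m%[n*o]/o≡m/o%n x 2 N))

    ≡ᵇ-%2N : ∀ a b → (a % (2 * N) ≡ᵇ b % (2 * N)) ≡ ((a % N ≡ᵇ b % N) ∧ (bit a ≡ᵇ bit b))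
    ≡ᵇ-%2N a b with a % N ≟ b % N
    ... | yes a≡b = trans
          (≡ᵇ-cong-⇔ (λ eq → trans (sym (m%[n*o]/o≡m/o%n a 2 N)) (trans (cong (_/ N) eq) (m%[n*o]/o≡m/o%n b 2 N)))
                     (λ eq → trans (%2N≡%N+bit a) (trans (cong₂ (λ r q → r + q * N) a≡b eq) (sym (%2N≡%N+bit b)))))
          (sym (cong (_∧ (bit a ≡ᵇ bit b)) (dec-true (a % N ≟ b % N) a≡b)))
    ... | no a≢b = trans
          (dec-false (a % (2 * N) ≟ b % (2 * N)) (λ eq → a≢b (trans (sym (%2N%N a)) (trans (cong (_% N) eq) (%2N%N b)))))
          (sym (cong (_∧ (bit a ≡ᵇ bit b)) (dec-false (a % N ≟ b % N) a≢b)))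

    eqMod-2N : ∀ a b → eqMod (2 * N) a b ≡ eqMod N a b * 𝟙 (bit a ≡ᵇ bit b)
    eqMod-2N a b = trans (cong 𝟙 (≡ᵇ-%2N a b)) (𝟙-∧ (a % N ≡ᵇ b % N) _)

  eqMod-split : ∀ a b → eqMod N a b ≡ eqMod (2 * N) a b + eqMod (2 * N) (N + a) b
  eqMod-split a b = sym (begin
      eqMod (2 * N) a b + eqMod (2 * N) (N + a) b
    ≡⟨ cong₂ _+_ (eqMod-2N a b) (eqMod-2N (N + a) b) ⟩
      e * 𝟙 (bit a ≡ᵇ bit b) + 𝟙 ((N + a) % N ≡ᵇ b % N) * 𝟙 (bit (N + a) ≡ᵇ bit b)
    ≡⟨ cong₂ (λ r q → e * 𝟙 (bit a ≡ᵇ bit b) + 𝟙 (r ≡ᵇ b % N) * 𝟙 (q % 2 ≡ᵇ bit b)) N+a%N N+a/N ⟩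
      e * 𝟙 (bit a ≡ᵇ bit b) + e * 𝟙 (suc (a / N) % 2 ≡ᵇ bit b)
    ≡⟨ *-distribˡ-+ e _ _ ⟨
      e * (𝟙 (bit a ≡ᵇ bit b) + 𝟙 (suc (a / N) % 2 ≡ᵇ bit b))
    ≡⟨ cong (e *_) (consecutive-parity (a / N) (b / N)) ⟩
      e * 1
    ≡⟨ *-identityʳ e ⟩
      e ∎)
    where
      open ≡-Reasoning
      e = eqMod N a b
      N+a%N : (N + a) % N ≡ a % N
      N+a%N = trans (cong (_% N) (+-comm N a)) ([m+n]%n≡m%n a N)
      N+a/N : (N + a) / N ≡ suc (a / N)
      N+a/N = trans (m/n≡1+[m∸n]/n (m≤m+n N a)) (cong (λ z → suc (z / N)) (m+n∸m≡n N a))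

module _ (p : ℕ) .{{_ : NonZero (2 * p)}} .{{_ : NonZero (2 * (2 * p))}} where

  square-%-double : ∀ x → (x % (2 * p)) * (x % (2 * p)) % (2 * (2 * p)) ≡ x * x % (2 * (2 * p))
  square-%-double x = sym (begin
      x * x % (2 * (2 * p))
    ≡⟨ cong (λ y → y * y % (2 * (2 * p))) (m≡m%n+[m/n]*n x (2 * p)) ⟩
      (r + q * (2 * p)) * (r + q * (2 * p)) % (2 * (2 * p))
    ≡⟨ cong (_% (2 * (2 * p))) (square-expand r q p) ⟩
      (r * r + (r * q + p * q * q) * (2 * (2 * p))) % (2 * (2 * p))
    ≡⟨ [m+kn]%n≡m%n (r * r) (r * q + p * q * q) (2 * (2 * p)) ⟩
      r * r % (2 * (2 * p)) ∎)
    where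
      open ≡-Reasoning
      r = x % (2 * p)
      q = x / (2 * p)
      square-expand : ∀ r q p → (r + q * (2 * p)) * (r + q * (2 * p)) ≡ r * r + (r * q + p * q * q) * (2 * (2 * p))
      square-expand = solve-∀

  anyOdd-%-even : ∀ {k} (v : Vec ℕ k) → anyOdd (vmap (_% (2 * p)) v) ≡ anyOdd v
  anyOdd-%-even []      = refl
  anyOdd-%-even (x ∷ v) = cong₂ (λ r b → (r ≡ᵇ 1) ∨ b)
    (m∣n⇒o%n%m≡o%m 2 (2 * p) x (divides p (*-comm 2 p))) (anyOdd-%-even v)

module Hensel (u μ : ℕ) where

  p m N : ℕ
  p = 2 ^ u
  m = 2 ^ (2 + u)
  N = 2 ^ (3 + u)

  instance
    m≢0 : NonZero m
    m≢0 = m^n≢0 2 (2 + u)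
    N≢0 : NonZero N
    N≢0 = m^n≢0 2 (3 + u)
    2N≢0 : NonZero (2 * N)
    2N≢0 = m^n≢0 2 (4 + u)

  count : (k c : ℕ) → ℕ
  count k c = sumBox N k (λ v → eqMod (2 * N) (c + sumOfSquares v) μ)

  oddCount : (k c : ℕ) → ℕ
  oddCount k c = sumBox N k (λ v → 𝟙 (anyOdd v) * eqMod (2 * N) (c + sumOfSquares v) μ)

  count-periodic : ∀ k c j → count k (c + j * (2 * N)) ≡ count k c
  count-periodic k c j = sumBox-cong N k (λ v → cong (λ z → 𝟙 (z ≡ᵇ μ % (2 * N)))
    (trans (cong (_% (2 * N)) (+-right-comm c (j * (2 * N)) (sumOfSquares v)))
           ([m+kn]%n≡m%n (c + sumOfSquares v) j (2 * N))))

  oddTerm evenTerm : (k c x : ℕ) → ℕ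
  oddTerm  k c x = 𝟙 (isOdd x) * count k (c + x * x)
  evenTerm k c x = 𝟙 (not (isOdd x)) * oddCount k (c + x * x)

  oddCount-suc : ∀ k c → oddCount (suc k) c ≡ sumBelow N (oddTerm k c) + sumBelow N (evenTerm k c)
  oddCount-suc k c = trans (sumBelow-cong N split-first) (sumBelow-+ N (oddTerm k c) (evenTerm k c))
    where
      open ≡-Reasoning
      E : ℕ → ℕ
      E z = eqMod (2 * N) z μ
      split-first : ∀ x → sumBox N k (λ v → 𝟙 (isOdd x ∨ anyOdd v) * E (c + (x * x + sumOfSquares v)))
                        ≡ oddTerm k c x + evenTerm k c x
      split-first x = begin
          sumBox N k (λ v → 𝟙 (isOdd x ∨ anyOdd v) * E (c + (x * x + sumOfSquares v)))
        ≡⟨ sumBox-cong N k (λ v → trans (cong (λ z → 𝟙 (isOdd x ∨ anyOdd v) * E z) (sym (+-assoc c (x * x) _)))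
                                        (𝟙-∨-split (isOdd x) (anyOdd v) _)) ⟩
          sumBox N k (λ v → 𝟙 (isOdd x) * E (c + x * x + sumOfSquares v)
                          + 𝟙 (not (isOdd x)) * (𝟙 (anyOdd v) * E (c + x * x + sumOfSquares v)))
        ≡⟨ sumBox-+ N k _ _ ⟩
          sumBox N k (λ v → 𝟙 (isOdd x) * E (c + x * x + sumOfSquares v))
          + sumBox N k (λ v → 𝟙 (not (isOdd x)) * (𝟙 (anyOdd v) * E (c + x * x + sumOfSquares v)))
        ≡⟨ cong₂ _+_ (sumBox-*ˡ N k (𝟙 (isOdd x)) (λ v → E (c + x * x + sumOfSquares v)))
                     (sumBox-*ˡ N k (𝟙 (not (isOdd x))) (λ v → 𝟙 (anyOdd v) * E (c + x * x + sumOfSquares v))) ⟩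
          oddTerm k c x + evenTerm k c x ∎

  isOdd-m+ : ∀ x → isOdd (m + x) ≡ isOdd x
  isOdd-m+ x = cong (_≡ᵇ 1) (trans (cong (_% 2) (trans (+-comm m x) (cong (x +_) (*-comm 2 (2 * p)))))
                                   ([m+kn]%n≡m%n x (2 * p) 2))

  -- (m + x)² = x² + 2mx + m² with 2m = N and x odd; m² is a multiple of 2N.
  square-shift : ∀ x → isOdd x ≡ true → (m + x) * (m + x) ≡ x * x + N + (p + x / 2) * (2 * N)
  square-shift x odd = begin
      (m + x) * (m + x)                    ≡⟨ cong (λ z → (m + z) * (m + z)) x≡y ⟩
      (m + y) * (m + y)                    ≡⟨ expand p (x / 2) ⟩
      y * y + N + (p + x / 2) * (2 * N)    ≡⟨ cong (λ z → z * z + N + (p + x / 2) * (2 * N)) x≡y ⟨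
      x * x + N + (p + x / 2) * (2 * N)    ∎
    where
      open ≡-Reasoning
      y = 1 + x / 2 * 2
      x≡y : x ≡ y
      x≡y = trans (m≡m%n+[m/n]*n x 2) (cong (_+ x / 2 * 2) (isOdd⇒%2≡1 x odd))
      expand : ∀ p j → (2 * (2 * p) + (1 + j * 2)) * (2 * (2 * p) + (1 + j * 2))
                     ≡ (1 + j * 2) * (1 + j * 2) + 2 * (2 * (2 * p)) + (p + j) * (2 * (2 * (2 * (2 * p))))
      expand = solve-∀

  oddTerm-shift₁ : ∀ k c x → oddTerm k (c + N) (m + x) ≡ oddTerm k c x
  oddTerm-shift₁ k c x = trans (cong (λ b → 𝟙 b * count k (c + N + (m + x) * (m + x))) (isOdd-m+ x))
    (𝟙-*-cong (isOdd x) (λ odd → begin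
      count k (c + N + (m + x) * (m + x))                      ≡⟨ cong (λ z → count k (c + N + z)) (square-shift x odd) ⟩
      count k (c + N + (x * x + N + (p + x / 2) * (2 * N)))     ≡⟨ cong (count k) (regroup c (x * x) N (p + x / 2)) ⟩
      count k (c + x * x + (1 + (p + x / 2)) * (2 * N))         ≡⟨ count-periodic k (c + x * x) (1 + (p + x / 2)) ⟩
      count k (c + x * x)                                       ∎))
    where
      open ≡-Reasoning
      regroup : ∀ a b n j → a + n + (b + n + j * (2 * n)) ≡ a + b + (1 + j) * (2 * n)
      regroup = solve-∀

  oddTerm-shift₂ : ∀ k c x → oddTerm k (c + N) x ≡ oddTerm k c (m + x)
  oddTerm-shift₂ k c x = trans (𝟙-*-cong (isOdd x) (λ odd → begin
      count k (c + N + x * x)                                 ≡⟨ count-periodic k (c + N + x * x) (p + x / 2) ⟨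
      count k (c + N + x * x + (p + x / 2) * (2 * N))         ≡⟨ cong (count k) (regroup c (x * x) N _) ⟩
      count k (c + (x * x + N + (p + x / 2) * (2 * N)))       ≡⟨ cong (λ z → count k (c + z)) (square-shift x odd) ⟨
      count k (c + (m + x) * (m + x))                         ∎))
    (cong (λ b → 𝟙 b * count k (c + (m + x) * (m + x))) (sym (isOdd-m+ x)))
    where
      open ≡-Reasoning
      regroup : ∀ a b n d → a + n + b + d ≡ a + (b + n + d)
      regroup = solve-∀

  oddCount-shift : ∀ k c → oddCount k (c + N) ≡ oddCount k c
  oddCount-shift zero    c = refl
  oddCount-shift (suc k) c = begin
      oddCount (suc k) (c + N)
    ≡⟨ oddCount-suc k (c + N) ⟩
      sumBelow N (oddTerm k (c + N)) + sumBelow N (evenTerm k (c + N))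
    ≡⟨ cong₂ _+_ (sumBelow-swap-halves m (oddTerm-shift₁ k c) (oddTerm-shift₂ k c)) (sumBelow-cong N evenTerm-shift) ⟩
      sumBelow N (oddTerm k c) + sumBelow N (evenTerm k c)
    ≡⟨ oddCount-suc k c ⟨
      oddCount (suc k) c ∎
    where
      open ≡-Reasoning
      evenTerm-shift : ∀ x → evenTerm k (c + N) x ≡ evenTerm k c x
      evenTerm-shift x = cong (𝟙 (not (isOdd x)) *_)
        (trans (cong (oddCount k) (+-right-comm c N (x * x))) (oddCount-shift k (c + x * x)))

  oddSolutions-2N : ∀ k → oddSolutions k μ (2 * N) ≡ 2 ^ k * oddCount k 0
  oddSolutions-2N k = sumBox-periodic 2 N k _ (λ v → cong₂ (λ b z → 𝟙 b * 𝟙 (z ≡ᵇ μ % (2 * N)))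
    (anyOdd-%-even m v) (sumOfSquares-mod N (2 * N) (square-%-double m) v))

  oddSolutions-N : ∀ k → oddSolutions k μ N ≡ oddCount k 0 + oddCount k 0
  oddSolutions-N k = begin
      oddSolutions k μ N
    ≡⟨ sumBox-cong N k (λ v → trans (cong (𝟙 (anyOdd v) *_) (eqMod-split N (sumOfSquares v) μ))
                                    (*-distribˡ-+ (𝟙 (anyOdd v)) _ _)) ⟩
      sumBox N k (λ v → 𝟙 (anyOdd v) * eqMod (2 * N) (sumOfSquares v) μ
                      + 𝟙 (anyOdd v) * eqMod (2 * N) (N + sumOfSquares v) μ)
    ≡⟨ sumBox-+ N k _ _ ⟩
      oddCount k 0 + oddCount k N
    ≡⟨ cong (oddCount k 0 +_) (oddCount-shift k 0) ⟩
      oddCount k 0 + oddCount k 0 ∎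
    where open ≡-Reasoning

  oddSolutions-double : ∀ k → oddSolutions (suc k) μ (2 * N) ≡ 2 ^ k * oddSolutions (suc k) μ N
  oddSolutions-double k = begin
      oddSolutions (suc k) μ (2 * N)                  ≡⟨ oddSolutions-2N (suc k) ⟩
      2 * 2 ^ k * oddCount (suc k) 0                  ≡⟨ regroup (2 ^ k) (oddCount (suc k) 0) ⟩
      2 ^ k * (oddCount (suc k) 0 + oddCount (suc k) 0) ≡⟨ cong (2 ^ k *_) (oddSolutions-N (suc k)) ⟨
      2 ^ k * oddSolutions (suc k) μ N                ∎
    where
      open ≡-Reasoning
      regroup : ∀ a c → 2 * a * c ≡ a * (c + c)
      regroup = solve-∀

oddSolutions-from-8 : ∀ k u μ →
  oddSolutions (suc k) μ (2 ^ (3 + u)) {{m^n≢0 2 (3 + u)}} ≡ 2 ^ (u * k) * oddSolutions (suc k) μ (2 ^ 3)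
oddSolutions-from-8 k zero    μ = sym (+-identityʳ _)
oddSolutions-from-8 k (suc u) μ = begin
    oddSolutions (suc k) μ (2 ^ (4 + u)) {{m^n≢0 2 (4 + u)}}
  ≡⟨ Hensel.oddSolutions-double u μ k ⟩
    2 ^ k * oddSolutions (suc k) μ (2 ^ (3 + u)) {{m^n≢0 2 (3 + u)}}
  ≡⟨ cong (2 ^ k *_) (oddSolutions-from-8 k u μ) ⟩
    2 ^ k * (2 ^ (u * k) * oddSolutions (suc k) μ (2 ^ 3))
  ≡⟨ *-assoc (2 ^ k) (2 ^ (u * k)) _ ⟨
    2 ^ k * 2 ^ (u * k) * oddSolutions (suc k) μ (2 ^ 3)
  ≡⟨ cong (_* oddSolutions (suc k) μ (2 ^ 3)) (^-distribˡ-+-* 2 k (u * k)) ⟨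
    2 ^ (suc u * k) * oddSolutions (suc k) μ (2 ^ 3) ∎
  where open ≡-Reasoning

2^-mono-∣ : ∀ {m n} → m ≤ n → 2 ^ m ∣ 2 ^ n
2^-mono-∣ {m} {n} m≤n = divides (2 ^ (n ∸ m)) (begin
    2 ^ n                ≡⟨ cong (2 ^_) (m+[n∸m]≡n m≤n) ⟨
    2 ^ (m + (n ∸ m))    ≡⟨ ^-distribˡ-+-* 2 m (n ∸ m) ⟩
    2 ^ m * 2 ^ (n ∸ m)  ≡⟨ *-comm (2 ^ m) _ ⟩
    2 ^ (n ∸ m) * 2 ^ m  ∎)
  where open ≡-Reasoning

2^[1+r]∤2^r*odd : ∀ r {μ} → μ % 2 ≡ 1 → ¬ 2 ^ suc r ∣ 2 ^ r * μ
2^[1+r]∤2^r*odd r {μ} odd d = 0≢1+n (trans (sym (n∣m⇒m%n≡0 μ 2 2∣μ)) odd)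
  where
    2∣μ : 2 ∣ μ
    2∣μ = *-cancelˡ-∣ (2 ^ r) {{m^n≢0 2 r}} (subst (_∣ 2 ^ r * μ) (*-comm 2 (2 ^ r)) d)

solutions≡oddSolutions : ∀ k r s μ → μ % 2 ≡ 1 → r < suc s → r ≤ 1 →
  solutions k (2 ^ r * μ) (2 ^ suc s) {{m^n≢0 2 (suc s)}} ≡ oddSolutions k (2 ^ r * μ) (2 ^ suc s) {{m^n≢0 2 (suc s)}}
solutions≡oddSolutions k r s μ odd r<1+s r≤1 = begin
    solutions k (2 ^ r * μ) (2 * 2 ^ s)
  ≡⟨ solutions-split (2 ^ s) k (2 ^ r * μ) ⟩
    oddSolutions k (2 ^ r * μ) (2 * 2 ^ s) + evenPart (2 ^ s) k (2 ^ r * μ)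
  ≡⟨ cong (oddSolutions k (2 ^ r * μ) (2 * 2 ^ s) +_)
       (evenPart-≡0 (2 ^ s) k (2 ^ r * μ) (2 ^ suc r) {{m^n≢0 2 (suc r)}}
         (2^-mono-∣ r<1+s) (2^-mono-∣ (s≤s r≤1)) (2^[1+r]∤2^r*odd r odd)) ⟩
    oddSolutions k (2 ^ r * μ) (2 * 2 ^ s) + 0
  ≡⟨ +-identityʳ _ ⟩
    oddSolutions k (2 ^ r * μ) (2 * 2 ^ s) ∎
  where
    open ≡-Reasoning
    instance
      2^s≢0 : NonZero (2 ^ s)
      2^s≢0 = m^n≢0 2 s
      2^[1+s]≢0 : NonZero (2 * 2 ^ s)
      2^[1+s]≢0 = m^n≢0 2 (suc s)

sum-applyUpTo : ∀ n (f : ℕ → ℕ) → sum (applyUpTo f n) ≡ sumBelow n f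
sum-applyUpTo zero    f = refl
sum-applyUpTo (suc n) f = cong (f 0 +_) (sum-applyUpTo n (f ∘ suc))

sum-map-upTo : ∀ n (f : ℕ → ℕ) → sum (map f (upTo n)) ≡ sumBelow n f
sum-map-upTo n f = trans (cong sum (map-upTo f n)) (sum-applyUpTo n f)

4*/2^[2+e] : ∀ μ e → (4 * μ) /2^ (2 + e) ≡ μ /2^ e
4*/2^[2+e] μ e = trans (/-congʳ (quadruple (2 ^ e))) (m*n/m*o≡n/o 4 μ (2 ^ e))
  where
    instance
      2^e≢0 : NonZero (2 ^ e)
      2^e≢0 = m^n≢0 2 e
      2^[2+e]≢0 : NonZero (2 ^ (2 + e))
      2^[2+e]≢0 = m^n≢0 2 (2 + e)
      4*2^e≢0 : NonZero (4 * 2 ^ e)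
      4*2^e≢0 = m*n≢0 4 (2 ^ e)
    quadruple : ∀ x → 2 * (2 * x) ≡ 4 * x
    quadruple = solve-∀

2^[k*[1+i]] : ∀ k i → 2 ^ (k * suc i) ≡ 2 ^ k * 2 ^ (k * i)
2^[k*[1+i]] k i = trans (cong (2 ^_) (*-suc k i)) (^-distribˡ-+-* 2 k (k * i))

term : (k s μ i : ℕ) → ℕ
term k s μ i = 2 ^ (k * i) * 2 ^ ((s ∸ 2 * i ∸ 3) * (k ∸ 1)) * ρ¹ k (μ /2^ (2 * i)) 3

expansion : (k s μ h : ℕ) → ℕ
expansion k s μ h = sum (map (term k s μ) (upTo h)) + 2 ^ (k * h) * ρ¹ k (μ /2^ (2 * h)) (s ∸ 2 * h)

expansion-zero : ∀ k s μ → expansion k s μ 0 ≡ oddSolutions k μ (2 ^ s) {{m^n≢0 2 s}}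
expansion-zero k s μ = begin
    2 ^ (k * 0) * ρ¹ k (μ /2^ 0) s   ≡⟨ cong₂ (λ e ν → 2 ^ e * ρ¹ k ν s) (*-zeroʳ k) (n/1≡n μ) ⟩
    1 * ρ¹ k μ s                     ≡⟨ *-identityˡ _ ⟩
    ρ¹ k μ s                         ≡⟨ ρ¹≡oddSolutions k μ s ⟩
    oddSolutions k μ (2 ^ s) {{m^n≢0 2 s}} ∎
  where open ≡-Reasoning

term-zero : ∀ k s μ → term (suc k) (3 + s) μ 0 ≡ oddSolutions (suc k) μ (2 ^ (3 + s)) {{m^n≢0 2 (3 + s)}}
term-zero k s μ = begin
    2 ^ (suc k * 0) * 2 ^ (s * k) * ρ¹ (suc k) (μ /2^ 0) 3
  ≡⟨ cong₂ (λ e ν → 2 ^ e * 2 ^ (s * k) * ρ¹ (suc k) ν 3) (*-zeroʳ (suc k)) (n/1≡n μ) ⟩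
    1 * 2 ^ (s * k) * ρ¹ (suc k) μ 3
  ≡⟨ cong₂ _*_ (*-identityˡ (2 ^ (s * k))) (ρ¹≡oddSolutions (suc k) μ 3) ⟩
    2 ^ (s * k) * oddSolutions (suc k) μ (2 ^ 3)
  ≡⟨ oddSolutions-from-8 k s μ ⟨
    oddSolutions (suc k) μ (2 ^ (3 + s)) {{m^n≢0 2 (3 + s)}} ∎
  where open ≡-Reasoning

term-suc : ∀ k s μ i → term (suc k) (3 + s) (4 * μ) (suc i) ≡ 2 ^ suc k * term (suc k) (1 + s) μ i
term-suc k s μ i = begin
    2 ^ (K * suc i) * 2 ^ ((3 + s ∸ 2 * suc i ∸ 3) * k) * ρ¹ K ((4 * μ) /2^ (2 * suc i)) 3
  ≡⟨ cong (λ j → 2 ^ (K * suc i) * 2 ^ ((3 + s ∸ j ∸ 3) * k) * ρ¹ K ((4 * μ) /2^ j) 3) (*-suc 2 i) ⟩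
    2 ^ (K * suc i) * 2 ^ ((1 + s ∸ 2 * i ∸ 3) * k) * ρ¹ K ((4 * μ) /2^ (2 + 2 * i)) 3
  ≡⟨ cong₂ (λ a ν → a * 2 ^ ((1 + s ∸ 2 * i ∸ 3) * k) * ρ¹ K ν 3) (2^[k*[1+i]] K i) (4*/2^[2+e] μ (2 * i)) ⟩
    2 ^ K * 2 ^ (K * i) * 2 ^ ((1 + s ∸ 2 * i ∸ 3) * k) * ρ¹ K (μ /2^ (2 * i)) 3
  ≡⟨ reassoc (2 ^ K) (2 ^ (K * i)) _ _ ⟩
    2 ^ K * term K (1 + s) μ i ∎
  where
    open ≡-Reasoning
    K = suc k
    reassoc : ∀ a b c d → a * b * c * d ≡ a * (b * c * d)
    reassoc = solve-∀

last-suc : ∀ k s μ h → 2 ^ (suc k * suc h) * ρ¹ (suc k) ((4 * μ) /2^ (2 * suc h)) (3 + s ∸ 2 * suc h)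
                     ≡ 2 ^ suc k * (2 ^ (suc k * h) * ρ¹ (suc k) (μ /2^ (2 * h)) (1 + s ∸ 2 * h))
last-suc k s μ h = begin
    2 ^ (K * suc h) * ρ¹ K ((4 * μ) /2^ (2 * suc h)) (3 + s ∸ 2 * suc h)
  ≡⟨ cong (λ j → 2 ^ (K * suc h) * ρ¹ K ((4 * μ) /2^ j) (3 + s ∸ j)) (*-suc 2 h) ⟩
    2 ^ (K * suc h) * ρ¹ K ((4 * μ) /2^ (2 + 2 * h)) (1 + s ∸ 2 * h)
  ≡⟨ cong₂ (λ a ν → a * ρ¹ K ν (1 + s ∸ 2 * h)) (2^[k*[1+i]] K h) (4*/2^[2+e] μ (2 * h)) ⟩
    2 ^ K * 2 ^ (K * h) * ρ¹ K (μ /2^ (2 * h)) (1 + s ∸ 2 * h)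
  ≡⟨ *-assoc (2 ^ K) _ _ ⟩
    2 ^ K * (2 ^ (K * h) * ρ¹ K (μ /2^ (2 * h)) (1 + s ∸ 2 * h)) ∎
  where
    open ≡-Reasoning
    K = suc k

expansion-suc : ∀ k s μ h → expansion (suc k) (3 + s) (4 * μ) (suc h)
  ≡ oddSolutions (suc k) (4 * μ) (2 ^ (3 + s)) {{m^n≢0 2 (3 + s)}} + 2 ^ suc k * expansion (suc k) (1 + s) μ h
expansion-suc k s μ h = begin
    sum (map (term K (3 + s) (4 * μ)) (upTo (suc h))) + L
  ≡⟨ cong (_+ L) (sum-map-upTo (suc h) _) ⟩
    term K (3 + s) (4 * μ) 0 + sumBelow h (term K (3 + s) (4 * μ) ∘ suc) + L
  ≡⟨ cong₂ (λ a b → a + b + L) (term-zero k s (4 * μ))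
       (trans (sumBelow-cong h (term-suc k s μ)) (sumBelow-*ˡ h (2 ^ K) _)) ⟩
    O + 2 ^ K * sumBelow h (term K (1 + s) μ) + L
  ≡⟨ cong₂ (λ a b → O + 2 ^ K * a + b) (sym (sum-map-upTo h _)) (last-suc k s μ h) ⟩
    O + 2 ^ K * sum (map (term K (1 + s) μ) (upTo h)) + 2 ^ K * L'
  ≡⟨ +-assoc O _ _ ⟩
    O + (2 ^ K * sum (map (term K (1 + s) μ) (upTo h)) + 2 ^ K * L')
  ≡⟨ cong (O +_) (*-distribˡ-+ (2 ^ K) _ L') ⟨
    O + 2 ^ K * expansion K (1 + s) μ h ∎
  where
    open ≡-Reasoning
    K = suc k
    O = oddSolutions K (4 * μ) (2 ^ (3 + s)) {{m^n≢0 2 (3 + s)}}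
    L = 2 ^ (K * suc h) * ρ¹ K ((4 * μ) /2^ (2 * suc h)) (3 + s ∸ 2 * suc h)
    L' = 2 ^ (K * h) * ρ¹ K (μ /2^ (2 * h)) (1 + s ∸ 2 * h)

solutions≡expansion : ∀ k r s μ → μ % 2 ≡ 1 → r < s →
  solutions (suc k) (2 ^ r * μ) (2 ^ s) {{m^n≢0 2 s}} ≡ expansion (suc k) s (2 ^ r * μ) (r / 2)
solutions≡expansion k 0 (suc s) μ odd r<s =
  trans (solutions≡oddSolutions (suc k) 0 s μ odd r<s z≤n) (sym (expansion-zero (suc k) (suc s) _))
solutions≡expansion k 1 (suc s) μ odd r<s =
  trans (solutions≡oddSolutions (suc k) 1 s μ odd r<s (s≤s z≤n)) (sym (expansion-zero (suc k) (suc s) _))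
solutions≡expansion k (suc (suc r)) (suc (suc zero)) μ odd (s≤s (s≤s ()))
solutions≡expansion k (suc (suc r)) (suc (suc (suc s))) μ odd (s≤s (s≤s r<1+s)) = begin
    solutions K (2 ^ (2 + r) * μ) (2 ^ (3 + s))
  ≡⟨ cong (λ ν → solutions K ν (2 ^ (3 + s))) (quadruple (2 ^ r) μ) ⟩
    solutions K (4 * μ₂) (2 * 2 ^ (2 + s))
  ≡⟨ solutions-split (2 ^ (2 + s)) K (4 * μ₂) ⟩
    O + evenPart (2 * 2 ^ (1 + s)) K (4 * μ₂)
  ≡⟨ cong (O +_) (evenPart-4* (2 ^ (1 + s)) K μ₂) ⟩
    O + 2 ^ K * solutions K μ₂ (2 ^ (1 + s))
  ≡⟨ cong (λ z → O + 2 ^ K * z) (solutions≡expansion k r (suc s) μ odd r<1+s) ⟩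
    O + 2 ^ K * expansion K (1 + s) μ₂ (r / 2)
  ≡⟨ expansion-suc k s μ₂ (r / 2) ⟨
    expansion K (3 + s) (4 * μ₂) (suc (r / 2))
  ≡⟨ cong₂ (expansion K (3 + s)) (quadruple (2 ^ r) μ) (m/n≡1+[m∸n]/n {2 + r} {2} (s≤s (s≤s z≤n))) ⟨
    expansion K (3 + s) (2 ^ (2 + r) * μ) ((2 + r) / 2) ∎
  where
    open ≡-Reasoning
    K = suc k
    μ₂ = 2 ^ r * μ
    instance
      2^[1+s]≢0 : NonZero (2 ^ (1 + s))
      2^[1+s]≢0 = m^n≢0 2 (1 + s)
      2^[2+s]≢0 : NonZero (2 ^ (2 + s))
      2^[2+s]≢0 = m^n≢0 2 (2 + s)
      2^[3+s]≢0 : NonZero (2 ^ (3 + s))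
      2^[3+s]≢0 = m^n≢0 2 (3 + s)
    O = oddSolutions K (4 * μ₂) (2 ^ (3 + s))
    quadruple : ∀ a b → 2 * (2 * a) * b ≡ 4 * (a * b)
    quadruple = solve-∀

theorem3 : (s k lam r lam' : ℕ) → 1 ≤ s → 1 ≤ k → 0 < lam → lam < 2 ^ s →
    lam ≡ 2 ^ r * lam' → lam' % 2 ≡ 1 → r < s →
    ρ k lam (2 ^ s) {{m^n≢0 2 s}}
      ≡ sum (map (λ i → 2 ^ (k * i) * 2 ^ ((s ∸ 2 * i ∸ 3) * (k ∸ 1)) * ρ¹ k (lam /2^ (2 * i)) 3)
                 (upTo (r / 2)))
        + 2 ^ (k * (r / 2)) * ρ¹ k (lam /2^ (2 * (r / 2))) (s ∸ 2 * (r / 2))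
theorem3 s (suc k) .(2 ^ r * lam') r lam' _ _ _ _ refl odd r<s =
  trans (ρ≡solutions (suc k) (2 ^ r * lam') (2 ^ s) {{m^n≢0 2 s}}) (solutions≡expansion k r s lam' odd r<s)
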